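{- For every $p,q\in(0,1]$, the parametric distances $d^{(p)}$ and $d^{(q)}$ are equivalent: there exist constants $c_1,c_2>0$ such that for every two rooted phylogenies (for the triplet version), resp. every two unrooted phylogenies (for the quartet version), $T_1,T_2$ over the same taxon set, $c_1\, d^{(q)}(T_1,T_2)\le d^{(p)}(T_1,T_2)\le c_2\, d^{(q)}(T_1,T_2)$.
   Context: Rooted phylogeny: rooted tree with leaf set the taxon set, internal nodes with at least two children, resolved if exactly two. Unrooted phylogeny: unrooted tree with leaf set the taxon set, internal nodes of degree at least $3$, resolved if degree $3$. $T|X$: restriction to $X$ (minimal spanning subtree with degree-two nodes suppressed, except the root in the rooted case). Units: triplets (3-subsets) for rooted, quartets (4-subsets) for unrooted; $X$ resolved in $T$ if $T|X$ is fully resolved. $\mathcal{D}(T_1,T_2)$: units resolved in both with $T_1|X\ne T_2|X$; $\mathcal{R}_1$, $\mathcal{R}_2$: units resolved only in $T_1$, only in $T_2$. $d^{(p)}(T_1,T_2)=|\mathcal{D}(T_1,T_2)|+p(|\mathcal{R}_1(T_1,T_2)|+|\mathcal{R}_2(T_1,T_2)|)$.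
   Formalization: The parameters p and q range only over rational numbers in (0,1], and the constants c₁, c₂ are taken in ℚ. -}

module Defs where

open import Data.Bool using (Bool; true; false; not; _∧_; _∨_; if_then_else_; T)
open import Data.Bool.Properties using (T?) renaming (_≟_ to _≟B_)
open import Data.Nat using (ℕ; zero; suc; _*_; _∸_)
open import Data.Nat.Properties using () renaming (_≟_ to _≟ℕ_)
open import Data.Integer using (+_)
open import Data.Fin using (Fin)
open import Data.Fin.Subset using (Subset; inside; outside; ⊤; ⁅_⁆; _⊆_; _∩_; ∁; ∣_∣; Nonempty; Empty)
open import Data.Fin.Subset.Properties using (nonempty?)
open import Data.List using (List; []; _∷_; [_]; map; _++_; filter; length; deduplicate)
open import Data.Bool.ListAction using (all; any)
open import Data.List.Membership.Propositional using () renaming (_∈_ to _∈L_)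
open import Data.List.Relation.Unary.All using (All)
open import Data.Product using (_×_; _,_; proj₁; proj₂)
import Data.Product.Properties as ×P
open import Data.Sum using (_⊎_)
open import Data.Vec using (Vec; []; _∷_)
import Data.Vec.Properties as VecP
open import Data.Rational using (ℚ; _+_; _/_) renaming (_*_ to _*ℚ_)
open import Relation.Nullary using (does)
open import Relation.Binary.PropositionalEquality using (_≡_)
open import Relation.Binary.Definitions using (DecidableEquality)

_≟S_ : ∀ {n} → DecidableEquality (Subset n)
_≟S_ = VecP.≡-dec _≟B_

allSubsets : (n : ℕ) → List (Subset n)
allSubsets zero    = [ [] ]
allSubsets (suc n) = map (outside ∷_) (allSubsets n) ++ map (inside ∷_) (allSubsets n)

kSubsets : (k n : ℕ) → List (Subset n)
kSubsets k n = filter (λ X → ∣ X ∣ ≟ℕ k) (allSubsets n)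

triplets : (n : ℕ) → List (Subset n)
triplets = kSubsets 3

quartets : (n : ℕ) → List (Subset n)
quartets = kSubsets 4

sameSet : ∀ {A : Set} → DecidableEquality A → List A → List A → Bool
sameSet _≟_ xs ys =
  all (λ x → any (λ y → does (x ≟ y)) ys) xs ∧ all (λ y → any (λ x → does (x ≟ y)) xs) ys

distinct : ∀ {A : Set} → DecidableEquality A → List A → ℕ
distinct _≟_ xs = length (deduplicate _≟_ xs)

-- Rooted phylogenies on Fin n, encoded (up to isomorphism fixing the
-- leaves) by their cluster systems (hierarchies): the clusters are the
-- leaf sets below the nodes.

CompatibleClusters : ∀ {n} → Subset n → Subset n → Set
CompatibleClusters C D = C ⊆ D ⊎ D ⊆ C ⊎ Empty (C ∩ D)

record RootedPhylogeny (n : ℕ) : Set where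
  field
    clusters   : List (Subset n)
    nonempty   : All Nonempty clusters
    hasRoot    : ⊤ ∈L clusters
    hasLeaves  : ∀ (x : Fin n) → ⁅ x ⁆ ∈L clusters
    compatible : ∀ {C D} → C ∈L clusters → D ∈L clusters → CompatibleClusters C D
open RootedPhylogeny public

restrictR : ∀ {n} → RootedPhylogeny n → Subset n → List (Subset n)
restrictR T X = filter nonempty? (map (_∩ X) (clusters T))

-- T|X is fully resolved (binary) iff it has 2|X|-1 distinct clusters
resolvedR : ∀ {n} → RootedPhylogeny n → Subset n → Bool
resolvedR T X = does (distinct _≟S_ (restrictR T X) ≟ℕ (2 * ∣ X ∣ ∸ 1))

sameRestrictionR : ∀ {n} → RootedPhylogeny n → RootedPhylogeny n → Subset n → Bool
sameRestrictionR T₁ T₂ X = sameSet _≟S_ (restrictR T₁ X) (restrictR T₂ X)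

-- Unrooted phylogenies on Fin n, encoded (up to isomorphism fixing the
-- leaves) by their split systems: each edge e gives the split A | ∁ A
-- of the leaves; a split is stored by one of its sides A.

CompatibleSplits : ∀ {n} → Subset n → Subset n → Set
CompatibleSplits A B =
  Empty (A ∩ B) ⊎ Empty (A ∩ ∁ B) ⊎ Empty (∁ A ∩ B) ⊎ Empty (∁ A ∩ ∁ B)

record UnrootedPhylogeny (n : ℕ) : Set where
  field
    splits     : List (Subset n)
    proper     : All (λ A → Nonempty A × Nonempty (∁ A)) splits
    hasLeaves  : ∀ (x : Fin n) → Nonempty (∁ ⁅ x ⁆) → ⁅ x ⁆ ∈L splits ⊎ ∁ ⁅ x ⁆ ∈L splits
    compatible : ∀ {A B} → A ∈L splits → B ∈L splits → CompatibleSplits A B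
open UnrootedPhylogeny public

-- lexicographic order on subsets, used to put an unordered split {A,B}
-- into a canonical form (A,B) with A ≤ B
lexLeq : ∀ {n} → Subset n → Subset n → Bool
lexLeq []       []       = true
lexLeq (x ∷ xs) (y ∷ ys) =
  if does (x ≟B y) then lexLeq xs ys else not x

Split : ℕ → Set
Split n = Subset n × Subset n

canonSplit : ∀ {n} → Subset n → Subset n → Split n
canonSplit A B = if lexLeq A B then (A , B) else (B , A)

_≟Sp_ : ∀ {n} → DecidableEquality (Split n)
_≟Sp_ = ×P.≡-dec _≟S_ _≟S_

restrictSplit : ∀ {n} → Subset n → Subset n → List (Split n)
restrictSplit X A with does (nonempty? (A ∩ X)) ∧ does (nonempty? (∁ A ∩ X))
... | true  = [ canonSplit (A ∩ X) (∁ A ∩ X) ]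
... | false = []

restrictU : ∀ {n} → UnrootedPhylogeny n → Subset n → List (Split n)
restrictU T X = Data.List.concatMap (restrictSplit X) (splits T)

-- T|X is fully resolved (all internal degrees 3) iff it has 2|X|-3 distinct splits
resolvedU : ∀ {n} → UnrootedPhylogeny n → Subset n → Bool
resolvedU T X = does (distinct _≟Sp_ (restrictU T X) ≟ℕ (2 * ∣ X ∣ ∸ 3))

sameRestrictionU : ∀ {n} → UnrootedPhylogeny n → UnrootedPhylogeny n → Subset n → Bool
sameRestrictionU T₁ T₂ X = sameSet _≟Sp_ (restrictU T₁ X) (restrictU T₂ X)

count : ∀ {n} → (Subset n → Bool) → List (Subset n) → ℕ
count P us = length (filter (λ X → T? (P X)) us)

ℕtoℚ : ℕ → ℚ
ℕtoℚ k = (+ k) / 1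

sizeD : ∀ {n} → List (Subset n) → (Subset n → Bool) → (Subset n → Bool) → (Subset n → Bool) → ℕ
sizeD us r₁ r₂ same = count (λ X → r₁ X ∧ r₂ X ∧ not (same X)) us

sizeR : ∀ {n} → List (Subset n) → (Subset n → Bool) → (Subset n → Bool) → ℕ
sizeR us r₁ r₂ = count (λ X → r₁ X ∧ not (r₂ X)) us

paramDist : ∀ {n} → ℚ → List (Subset n) → (Subset n → Bool) → (Subset n → Bool) → (Subset n → Bool) → ℚ
paramDist p us r₁ r₂ same =
  ℕtoℚ (sizeD us r₁ r₂ same) + p *ℚ (ℕtoℚ (sizeR us r₁ r₂) + ℕtoℚ (sizeR us r₂ r₁))

dTriplet : ℚ → ∀ {n} → RootedPhylogeny n → RootedPhylogeny n → ℚ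
dTriplet p {n} T₁ T₂ =
  paramDist p (triplets n) (resolvedR T₁) (resolvedR T₂) (sameRestrictionR T₁ T₂)

dQuartet : ℚ → ∀ {n} → UnrootedPhylogeny n → UnrootedPhylogeny n → ℚ
dQuartet p {n} T₁ T₂ =
  paramDist p (quartets n) (resolvedU T₁) (resolvedU T₂) (sameRestrictionU T₁ T₂)

{-# OPTIONS --safe #-}
module Submission where

open import Defs
open import Data.Nat using (ℕ)
open import Data.Product using (Σ; _×_; _,_)
open import Data.Rational using (ℚ; 0ℚ; 1ℚ; _≤_; _<_; _*_; _+_; 1/_; NonNegative; Positive; NonZero; positive)
open import Data.Rational.Properties
open import Data.List using (List)
open import Data.Fin.Subset using (Subset)
open import Relation.Binary.PropositionalEquality using (sym; cong)
open import Algebra.Bundles using (CommutativeMonoid)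
import Algebra.Properties.CommutativeSemigroup as CommutativeSemigroupProperties

-- Every d^(p) has the shape |𝒟| + p·(|ℛ₁| + |ℛ₂|) with the same two nonnegative
-- counts, so for p, q ∈ (0, 1] it is squeezed between p·d^(q) and d^(q)/q,
-- uniformly in the trees and in the kind of unit.

weightedSum : ℚ → ℚ → ℚ → ℚ
weightedSum p D R = D + p * R

x≤1⇒x*y≤y : ∀ {x} y .{{_ : NonNegative y}} → x ≤ 1ℚ → x * y ≤ y
x≤1⇒x*y≤y {x} y x≤1 = begin
  x * y   ≤⟨ *-monoʳ-≤-nonNeg y x≤1 ⟩
  1ℚ * y  ≡⟨ *-identityˡ y ⟩
  y       ∎
  where open ≤-Reasoning

*-weightedSum-≤ : ∀ {p q} D R .{{_ : NonNegative p}} .{{_ : NonNegative D}} .{{_ : NonNegative R}} →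
  p ≤ 1ℚ → q ≤ 1ℚ → p * weightedSum q D R ≤ weightedSum p D R
*-weightedSum-≤ {p} {q} D R p≤1 q≤1 = begin
  p * (D + q * R)       ≡⟨ *-distribˡ-+ p D (q * R) ⟩
  p * D + p * (q * R)   ≡⟨ cong (p * D +_) (x∙yz≈y∙xz p q R) ⟩
  p * D + q * (p * R)   ≤⟨ +-mono-≤ (x≤1⇒x*y≤y D p≤1) (x≤1⇒x*y≤y (p * R) {{pR≥0}} q≤1) ⟩
  D + p * R             ∎
  where
  open ≤-Reasoning
  open CommutativeSemigroupProperties (CommutativeMonoid.commutativeSemigroup *-1-commutativeMonoid)
    using (x∙yz≈y∙xz)
  pR≥0 : NonNegative (p * R)
  pR≥0 = nonNeg*nonNeg⇒nonNeg p R

weightedSum-≤-1/*-weightedSum : ∀ {p q} D R .{{_ : Positive q}} .{{_ : NonNegative D}} .{{_ : NonNegative R}} →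
  p ≤ 1ℚ → q ≤ 1ℚ → weightedSum p D R ≤ (1/ q) {{pos⇒nonZero q}} * weightedSum q D R
weightedSum-≤-1/*-weightedSum {p} {q} D R p≤1 q≤1 = begin
  weightedSum p D R               ≡⟨ sym (*-identityˡ _) ⟩
  1ℚ * weightedSum p D R          ≡⟨ cong (_* weightedSum p D R) (sym (*-inverseˡ q)) ⟩
  (1/ q * q) * weightedSum p D R  ≡⟨ *-assoc (1/ q) q _ ⟩
  1/ q * (q * weightedSum p D R)  ≤⟨ *-monoˡ-≤-nonNeg (1/ q) {{1/q≥0}} (*-weightedSum-≤ D R q≤1 p≤1) ⟩
  1/ q * weightedSum q D R        ∎
  where
  open ≤-Reasoning
  instance
    q≢0 : NonZero q
    q≢0 = pos⇒nonZero q
    q≥0 : NonNegative q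
    q≥0 = pos⇒nonNeg q
  1/q≥0 : NonNegative (1/ q)
  1/q≥0 = pos⇒nonNeg (1/ q) {{1/pos⇒pos q}}

ℕtoℚ-nonNeg : ∀ k → NonNegative (ℕtoℚ k)
ℕtoℚ-nonNeg k = normalize-nonNeg k 1

paramDist-equivalent : ∀ {p q} .{{_ : Positive p}} .{{_ : Positive q}} → p ≤ 1ℚ → q ≤ 1ℚ →
  ∀ {n} (us : List (Subset n)) r₁ r₂ same →
  (p * paramDist q us r₁ r₂ same ≤ paramDist p us r₁ r₂ same) ×
  (paramDist p us r₁ r₂ same ≤ (1/ q) {{pos⇒nonZero q}} * paramDist q us r₁ r₂ same)
paramDist-equivalent {p} p≤1 q≤1 us r₁ r₂ same =
    *-weightedSum-≤ D R {{pos⇒nonNeg p}} p≤1 q≤1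
  , weightedSum-≤-1/*-weightedSum D R p≤1 q≤1
  where
  R₁ R₂ : ℕ
  R₁ = sizeR us r₁ r₂
  R₂ = sizeR us r₂ r₁
  D R : ℚ
  D = ℕtoℚ (sizeD us r₁ r₂ same)
  R = ℕtoℚ R₁ + ℕtoℚ R₂
  instance
    D≥0 : NonNegative D
    D≥0 = ℕtoℚ-nonNeg (sizeD us r₁ r₂ same)
    R≥0 : NonNegative R
    R≥0 = nonNeg+nonNeg⇒nonNeg (ℕtoℚ R₁) {{ℕtoℚ-nonNeg R₁}} (ℕtoℚ R₂) {{ℕtoℚ-nonNeg R₂}}

proposition1 : (p q : ℚ) → 0ℚ < p → p ≤ 1ℚ → 0ℚ < q → q ≤ 1ℚ →
    (Σ ℚ λ c₁ → Σ ℚ λ c₂ → 0ℚ < c₁ × 0ℚ < c₂ ×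
      ((n : ℕ) (T₁ T₂ : RootedPhylogeny n) →
        (c₁ * dTriplet q T₁ T₂ ≤ dTriplet p T₁ T₂) × (dTriplet p T₁ T₂ ≤ c₂ * dTriplet q T₁ T₂)))
    ×
    (Σ ℚ λ c₁ → Σ ℚ λ c₂ → 0ℚ < c₁ × 0ℚ < c₂ ×
      ((n : ℕ) (T₁ T₂ : UnrootedPhylogeny n) →
        (c₁ * dQuartet q T₁ T₂ ≤ dQuartet p T₁ T₂) × (dQuartet p T₁ T₂ ≤ c₂ * dQuartet q T₁ T₂)))
proposition1 p q 0<p p≤1 0<q q≤1 =
    (p , 1/ q , 0<p , 0<1/q , λ n T₁ T₂ →
      paramDist-equivalent p≤1 q≤1 (triplets n) (resolvedR T₁) (resolvedR T₂) (sameRestrictionR T₁ T₂))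
  , (p , 1/ q , 0<p , 0<1/q , λ n T₁ T₂ →
      paramDist-equivalent p≤1 q≤1 (quartets n) (resolvedU T₁) (resolvedU T₂) (sameRestrictionU T₁ T₂))
  where
  instance
    p>0 : Positive p
    p>0 = positive 0<p
    q>0 : Positive q
    q>0 = positive 0<q
    q≢0 : NonZero q
    q≢0 = pos⇒nonZero q
  0<1/q : 0ℚ < 1/ q
  0<1/q = positive⁻¹ (1/ q) {{1/pos⇒pos q}}
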